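{- Let $r\ge2$ and $\gamma,\gamma'\in WNC(n,d,r)$. Suppose that for each $i=1,\dots,r-1$ the set $\{m: m \text{ is the } i\text{ -th smallest element of some block of }\gamma\}$ equals the corresponding set for $\gamma'$, and that $\{m: m\text{ is the largest element of some block of }\gamma\}$ equals the corresponding set for $\gamma'$. Then $\gamma=\gamma'$. That is, an $r$-weakly noncrossing set partition is uniquely determined by these $r$ sets.
   Context: Two arcs $(p,q)$ and $(s,t)$ (with $p<q$, $s<t$) cross if $p<s<q<t$ or $s<p<t<q$. Two subsets $A=\{a_1<\dots<a_{|A|}\}$, $B=\{b_1<\dots<b_{|B|}\}$ of $[n]$, each of size $\ge r$, are $r$-weakly noncrossing if (1) for each $i=1,\dots,r-2$ the arc $(a_i,a_{i+1})$ does not cross $(b_i,b_{i+1})$, and (2) for all $j_1,j_2\ge r$ the arc $(a_{r-1},a_{j_1})$ does not cross $(b_{r-1},b_{j_2})$. A set partition is $r$-weakly noncrossing if its blocks are pairwise $r$-weakly noncrossing. $WNC(n,d,r)$ is the set of $r$-weakly noncrossing set partitions of $[n]$ into $d$ blocks each of size at least $r$. -}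

module Defs where

open import Data.Nat using (ℕ; zero; suc; _≤_; _<_; _∸_)
open import Data.Fin using (Fin)
open import Data.Fin.Subset using (Subset; Side; inside; outside; ∣_∣)
open import Data.Vec using (Vec; []; _∷_)
open import Data.List using (List; []; _∷_; length)
open import Data.List.Relation.Unary.All using (All)
open import Data.List.Relation.Unary.Any using (Any)
open import Data.List.Relation.Unary.AllPairs using (AllPairs)
open import Data.Product using (_×_)
open import Data.Sum using (_⊎_)
open import Relation.Nullary using (¬_)
open import Relation.Binary.PropositionalEquality using (_≡_)

-- A block is a subset of [n] (Data.Fin.Subset); position k : Fin n stands
-- for the number toℕ k + 1, so that [n] = {1, ..., n}.

elemsFrom : ∀ {n} → ℕ → Vec Side n → List ℕ
elemsFrom k []              = []
elemsFrom k (inside  ∷ v)   = k ∷ elemsFrom (suc k) v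
elemsFrom k (outside ∷ v)   = elemsFrom (suc k) v

elements : ∀ {n} → Subset n → List ℕ
elements = elemsFrom 1

-- at l i : the i-th entry of l, 1-based (i.e. a_i).  The value 0 returned
-- outside the range 1..length l is never used: every use below is guarded.
at : List ℕ → ℕ → ℕ
at []       _             = 0
at (x ∷ xs) zero          = 0
at (x ∷ xs) (suc zero)    = x
at (x ∷ xs) (suc (suc i)) = at xs (suc i)

Cross : ℕ → ℕ → ℕ → ℕ → Set
Cross p q s t = (p < s × s < q × q < t) ⊎ (s < p × p < t × t < q)

WeaklyNC : ℕ → List ℕ → List ℕ → Set
WeaklyNC r a b =
  r ≤ length a × r ≤ length b ×
  (∀ i → 1 ≤ i → i ≤ r ∸ 2 →
     ¬ Cross (at a i) (at a (suc i)) (at b i) (at b (suc i))) ×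
  (∀ j₁ j₂ → r ≤ j₁ → j₁ ≤ length a → r ≤ j₂ → j₂ ≤ length b →
     ¬ Cross (at a (r ∸ 1)) (at a j₁) (at b (r ∸ 1)) (at b j₂))

BlocksWeaklyNC : ∀ {n} → ℕ → Subset n → Subset n → Set
BlocksWeaklyNC r A B = WeaklyNC r (elements A) (elements B)

IsSetPartition : (n d : ℕ) → List (Subset n) → Set
IsSetPartition n d γ =
  length γ ≡ d ×
  AllPairs (λ A B → ∀ (x : Fin n) → ¬ (x S.∈ A × x S.∈ B)) γ ×
  (∀ (x : Fin n) → Any (x S.∈_) γ) ×
  All (λ A → 1 ≤ ∣ A ∣) γ
  where import Data.Fin.Subset as S

IsWNC : (n d r : ℕ) → List (Subset n) → Set
IsWNC n d r γ =
  IsSetPartition n d γ ×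
  All (λ A → r ≤ ∣ A ∣) γ ×
  AllPairs (BlocksWeaklyNC r) γ

IthSmallestSet : ∀ {n} → List (Subset n) → ℕ → ℕ → Set
IthSmallestSet γ i m =
  Any (λ A → 1 ≤ i × i ≤ length (elements A) × at (elements A) i ≡ m) γ

LargestSet : ∀ {n} → List (Subset n) → ℕ → Set
LargestSet γ m =
  Any (λ A → 1 ≤ length (elements A) × at (elements A) (length (elements A)) ≡ m) γ

-- For 1 ≤ i ≤ r-2 the arcs (a_i, a_{i+1}) of the blocks form a noncrossing
-- family, and so do the "tail arcs" (a_{r-1}, a_max).  A noncrossing family
-- of arcs with distinct left and distinct right endpoints is determined by its
-- sets of left and right endpoints.  Hence, starting from a common first
-- element, layer by layer, a block of γ and a block of γ′ share their first
-- r-1 elements and their largest element.  An element m strictly between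
-- a_{r-1} and a_max of such a block must lie in the same block of γ′ too: in
-- any other block it would be a middle element as well, and the tail arc of
-- one block would then cross an arc (a_{r-1}, m) of the other one.
module Submission where

open import Defs
open import Data.Nat using (ℕ; _≤_; _∸_)
open import Data.Fin.Subset using (Subset)
open import Data.List using (List)
open import Data.List.Membership.Propositional using (_∈_)
open import Function.Bundles using (_⇔_)

open import Data.Nat using (zero; suc; _<_; _+_; z≤n; s≤s; _≤?_; _≟_)
open import Data.Nat.Properties
  using ( ≤-refl; ≤-trans; <-irrefl; <-cmp; <⇒≤; n≤1+n; m≤n⇒m≤1+n; ≤∧≢⇒<; ≰⇒>
        ; +-suc; +-identityʳ; suc-injective)
open import Data.Nat.Induction using (<-wellFounded)
open import Induction.WellFounded using (Acc; acc)
open import Data.Fin using (Fin; toℕ) renaming (zero to fzero; suc to fsuc)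
open import Data.Fin.Properties using (toℕ-injective)
open import Data.Fin.Subset using (inside; outside; ∣_∣; _⊆_) renaming (_∈_ to _∈ₛ_)
open import Data.Fin.Subset.Properties using (⊆-antisym)
open import Data.Vec using ([]; _∷_; here; there)
open import Data.List using ([]; _∷_; length)
open import Data.List.Relation.Unary.All as All using (All)
open import Data.List.Relation.Unary.Any using (Any; here; there)
open import Data.List.Relation.Unary.AllPairs using (AllPairs; []; _∷_)
open import Data.List.Membership.Propositional using (find; lose)
open import Data.Product using (Σ; _×_; _,_; proj₁; proj₂)
open import Data.Sum using (_⊎_; inj₁; inj₂)
open import Data.Empty using (⊥; ⊥-elim)
open import Relation.Nullary using (¬_; yes; no)
open import Relation.Binary.PropositionalEquality
  using (_≡_; _≢_; refl; sym; trans; cong; subst; subst₂)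
open import Relation.Binary.Definitions using (tri<; tri≈; tri>)
open import Function.Bundles using (mk⇔; Equivalence)
open import Function.Base using (_$_)
import Function.Properties.Equivalence as ⇔

private
  variable
    X : Set
    n : ℕ

j≤l⇒j≤m⊎j≡l⊎m<j<l : ∀ {j l} m → j ≤ l → j ≤ m ⊎ j ≡ l ⊎ (m < j × j < l)
j≤l⇒j≤m⊎j≡l⊎m<j<l {j} {l} m j≤l with j ≤? m | j ≟ l
... | yes j≤m | _       = inj₁ j≤m
... | no _    | yes j≡l = inj₂ (inj₁ j≡l)
... | no j≰m  | no j≢l  = inj₂ (inj₂ (≰⇒> j≰m , ≤∧≢⇒< j≤l j≢l))

<-on⇒≢ : ∀ (f : X → ℕ) {x y} → f x < f y → x ≢ y
<-on⇒≢ f fx<fx refl = <-irrefl refl fx<fx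

lookup-AllPairs : ∀ {R : X → X → Set} {xs} → AllPairs R xs →
                  ∀ {a b} → a ∈ xs → b ∈ xs → a ≡ b ⊎ R a b ⊎ R b a
lookup-AllPairs (_  ∷ _)   (here refl) (here refl) = inj₁ refl
lookup-AllPairs (Rx ∷ _)   (here refl) (there b∈) = inj₂ (inj₁ (All.lookup Rx b∈))
lookup-AllPairs (Rx ∷ _)   (there a∈) (here refl) = inj₂ (inj₂ (All.lookup Rx a∈))
lookup-AllPairs (_  ∷ Rxs) (there a∈) (there b∈) = lookup-AllPairs Rxs a∈ b∈

Cross-sym : ∀ {p q s t} → Cross p q s t → Cross s t p q
Cross-sym (inj₁ c) = inj₂ c
Cross-sym (inj₂ c) = inj₁ c

WeaklyNC-sym : ∀ {r a b} → WeaklyNC r a b → WeaklyNC r b a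
WeaklyNC-sym (r≤a , r≤b , layers , tails) =
  r≤b , r≤a , (λ i p q cr → layers i p q (Cross-sym cr)) ,
  (λ j₂ j₁ p₂ q₂ p₁ q₁ cr → tails j₁ j₂ p₁ q₁ p₂ q₂ (Cross-sym cr))

Entry : List ℕ → ℕ → ℕ → Set
Entry l j v = 1 ≤ j × j ≤ length l × at l j ≡ v

length-elemsFrom : ∀ s (v : Subset n) → length (elemsFrom s v) ≡ ∣ v ∣
length-elemsFrom s []            = refl
length-elemsFrom s (inside  ∷ v) = cong suc (length-elemsFrom (suc s) v)
length-elemsFrom s (outside ∷ v) = length-elemsFrom (suc s) v

elemsFrom-≥ : ∀ s (v : Subset n) {j} → 1 ≤ j → j ≤ length (elemsFrom s v) → s ≤ at (elemsFrom s v) j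
elemsFrom-≥ s (inside ∷ v) {suc zero}    _ _         = ≤-refl
elemsFrom-≥ s (inside ∷ v) {suc (suc j)} _ (s≤s j≤) =
  ≤-trans (n≤1+n s) (elemsFrom-≥ (suc s) v (s≤s z≤n) j≤)
elemsFrom-≥ s (outside ∷ v) 1≤j j≤ = ≤-trans (n≤1+n s) (elemsFrom-≥ (suc s) v 1≤j j≤)

elemsFrom-increasing : ∀ s (v : Subset n) {i j} → 1 ≤ i → i < j → j ≤ length (elemsFrom s v) →
                       at (elemsFrom s v) i < at (elemsFrom s v) j
elemsFrom-increasing s (inside ∷ v) {suc zero} {suc zero} _ (s≤s ()) _
elemsFrom-increasing s (inside ∷ v) {suc zero} {suc (suc j)} _ _ (s≤s j≤) =
  elemsFrom-≥ (suc s) v (s≤s z≤n) j≤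
elemsFrom-increasing s (inside ∷ v) {suc (suc i)} {suc (suc j)} _ (s≤s i<j) (s≤s j≤) =
  elemsFrom-increasing (suc s) v (s≤s z≤n) i<j j≤
elemsFrom-increasing s (outside ∷ v) 1≤i i<j j≤ = elemsFrom-increasing (suc s) v 1≤i i<j j≤

∈⇒Entry : ∀ s (v : Subset n) {x} → x ∈ₛ v → Σ ℕ λ j → Entry (elemsFrom s v) j (s + toℕ x)
∈⇒Entry s (inside ∷ v) here = 1 , s≤s z≤n , s≤s z≤n , sym (+-identityʳ s)
∈⇒Entry s (inside ∷ v) {fsuc x} (there x∈) with ∈⇒Entry (suc s) v x∈
... | suc j , _ , j≤ , e = suc (suc j) , s≤s z≤n , s≤s j≤ , trans e (sym (+-suc s (toℕ x)))
∈⇒Entry s (outside ∷ v) {fsuc x} (there x∈) with ∈⇒Entry (suc s) v x∈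
... | j , entry , j≤ , e = j , entry , j≤ , trans e (sym (+-suc s (toℕ x)))

Entry⇒∈ : ∀ s (v : Subset n) {j w} → Entry (elemsFrom s v) j w → Σ (Fin n) λ x → s + toℕ x ≡ w × x ∈ₛ v
Entry⇒∈ s (inside ∷ v) {suc zero} (_ , _ , e) = fzero , trans (+-identityʳ s) e , here
Entry⇒∈ s (inside ∷ v) {suc (suc j)} (_ , s≤s j≤ , e) with Entry⇒∈ (suc s) v (s≤s z≤n , j≤ , e)
... | x , e′ , x∈ = fsuc x , trans (+-suc s (toℕ x)) e′ , there x∈
Entry⇒∈ s (outside ∷ v) entry with Entry⇒∈ (suc s) v entry
... | x , e′ , x∈ = fsuc x , trans (+-suc s (toℕ x)) e′ , there x∈

elements-Entry⇒∈ : ∀ {A : Subset n} {j} x → Entry (elements A) j (suc (toℕ x)) → x ∈ₛ A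
elements-Entry⇒∈ {A = A} x entry with Entry⇒∈ 1 A entry
... | y , e , y∈A = subst (_∈ₛ A) (toℕ-injective (suc-injective e)) y∈A

entryAt : ℕ → Subset n → ℕ
entryAt i A = at (elements A) i

lastEntry : Subset n → ℕ
lastEntry A = at (elements A) (length (elements A))

-- v lies strictly between a_{r-1} and the largest element of A, where r = 2 + k.
Middle : ℕ → Subset n → ℕ → Set
Middle k A v = Σ ℕ λ j → 2 + k ≤ j × j < length (elements A) × at (elements A) j ≡ v

-- Noncrossing arc families

module _ (o c : X → ℕ) where

  record NoncrossingArcs (δ : List X) : Set where
    field
      left<right      : ∀ {A} → A ∈ δ → o A < c A
      noncrossing     : ∀ {A C} → A ∈ δ → C ∈ δ → A ≢ C → ¬ Cross (o A) (c A) (o C) (c C)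
      left-injective  : ∀ {A C} → A ∈ δ → C ∈ δ → o A ≡ o C → A ≡ C
      right-injective : ∀ {A C} → A ∈ δ → C ∈ δ → c A ≡ c C → A ≡ C

  record EndpointsIncluded (δ δ′ : List X) : Set where
    field
      left∈  : ∀ {A} → A ∈ δ → Σ X λ B → B ∈ δ′ × o B ≡ o A
      right∈ : ∀ {A} → A ∈ δ → Σ X λ B → B ∈ δ′ × c B ≡ c A

open NoncrossingArcs
open EndpointsIncluded

module _ {o c : X → ℕ} {δ δ′ : List X}
         (arcs : NoncrossingArcs o c δ) (arcs′ : NoncrossingArcs o c δ′)
         (δ⊆δ′ : EndpointsIncluded o c δ δ′) (δ′⊆δ : EndpointsIncluded o c δ′ δ) where

  -- If A were shorter than A′, the arc B′ of δ′ ending at c A and the arc B of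
  -- δ starting at o B′ either cross A′ or A, or form a shorter such pair.
  sameLeft⇒¬shorter : ∀ {A A′} → Acc _<_ (c A) → A ∈ δ → A′ ∈ δ′ → o A ≡ o A′ → ¬ c A < c A′
  sameLeft⇒¬shorter {A} {A′} (acc shorter) A∈ A′∈ oA≡oA′ cA<cA′
    with right∈ δ⊆δ′ A∈
  ... | B′ , B′∈ , cB′≡cA with left∈ δ′⊆δ B′∈
  ... | B , B∈ , oB≡oB′ with <-cmp (o B′) (o A′)
  ... | tri≈ _ oB′≡oA′ _ =
    <-irrefl (trans (sym cB′≡cA) (cong c (left-injective arcs′ B′∈ A′∈ oB′≡oA′))) cA<cA′
  ... | tri< oB′<oA′ _ _ =
    noncrossing arcs′ B′∈ A′∈ (<-on⇒≢ o oB′<oA′)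
      (inj₁ (oB′<oA′ , subst₂ _<_ oA≡oA′ (sym cB′≡cA) (left<right arcs A∈)
                     , subst (_< c A′) (sym cB′≡cA) cA<cA′))
  ... | tri> _ _ oA′<oB′ with <-cmp (c B) (c A)
  ...   | tri≈ _ cB≡cA _ =
    <-irrefl (trans (sym oA≡oA′) (trans (cong o (sym (right-injective arcs B∈ A∈ cB≡cA))) oB≡oB′)) oA′<oB′
  ...   | tri> _ _ cA<cB =
    noncrossing arcs A∈ B∈ (<-on⇒≢ o oA<oB)
      (inj₁ (oA<oB , subst₂ _<_ (sym oB≡oB′) cB′≡cA (left<right arcs′ B′∈) , cA<cB))
    where oA<oB : o A < o B
          oA<oB = subst₂ _<_ (sym oA≡oA′) (sym oB≡oB′) oA′<oB′
  ...   | tri< cB<cA _ _ =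
    sameLeft⇒¬shorter (shorter cB<cA) B∈ B′∈ oB≡oB′ (subst (c B <_) (sym cB′≡cA) cB<cA)

sameLeft⇒sameRight : ∀ {o c : X → ℕ} {δ δ′} →
  NoncrossingArcs o c δ → NoncrossingArcs o c δ′ →
  EndpointsIncluded o c δ δ′ → EndpointsIncluded o c δ′ δ →
  ∀ {A A′} → A ∈ δ → A′ ∈ δ′ → o A ≡ o A′ → c A ≡ c A′
sameLeft⇒sameRight {c = c} arcs arcs′ δ⊆δ′ δ′⊆δ {A} {A′} A∈ A′∈ oA≡oA′ with <-cmp (c A) (c A′)
... | tri< cA<cA′ _ _ =
  ⊥-elim (sameLeft⇒¬shorter arcs arcs′ δ⊆δ′ δ′⊆δ (<-wellFounded _) A∈ A′∈ oA≡oA′ cA<cA′)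
... | tri≈ _ cA≡cA′ _ = cA≡cA′
... | tri> _ _ cA′<cA =
  ⊥-elim (sameLeft⇒¬shorter arcs′ arcs δ′⊆δ δ⊆δ′ (<-wellFounded _) A′∈ A∈ (sym oA≡oA′) cA′<cA)

-- r-weakly noncrossing partitions, written with r = 2 + k

module WNCPartition {n d k : ℕ} {δ : List (Subset n)} (wnc : IsWNC n d (2 + k) δ) where

  private
    partition = proj₁ wnc

  cover : ∀ x → Any (x ∈ₛ_) δ
  cover = proj₁ (proj₂ (proj₂ partition))

  length≥r : ∀ {A} → A ∈ δ → 2 + k ≤ length (elements A)
  length≥r {A} A∈ = subst (2 + k ≤_) (sym (length-elemsFrom 1 A)) (All.lookup (proj₁ (proj₂ wnc)) A∈)

  ≤-length : ∀ {A i} → A ∈ δ → i ≤ 2 + k → i ≤ length (elements A)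
  ≤-length A∈ i≤r = ≤-trans i≤r (length≥r A∈)

  sameEntry⇒sameBlock : ∀ {A C i j v} → A ∈ δ → C ∈ δ →
                        Entry (elements A) i v → Entry (elements C) j v → A ≡ C
  sameEntry⇒sameBlock {A} A∈ C∈ entryA entryC with Entry⇒∈ 1 A entryA
  ... | x , refl , x∈A with lookup-AllPairs (proj₁ (proj₂ partition)) A∈ C∈
  ...   | inj₁ A≡C        = A≡C
  ...   | inj₂ (inj₁ A#C) = ⊥-elim (A#C x (x∈A , elements-Entry⇒∈ x entryC))
  ...   | inj₂ (inj₂ C#A) = ⊥-elim (C#A x (elements-Entry⇒∈ x entryC , x∈A))

  weaklyNC : ∀ {A C} → A ∈ δ → C ∈ δ → A ≢ C → WeaklyNC (2 + k) (elements A) (elements C)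
  weaklyNC {A} {C} A∈ C∈ A≢C with lookup-AllPairs (proj₂ (proj₂ wnc)) A∈ C∈
  ... | inj₁ A≡C         = ⊥-elim (A≢C A≡C)
  ... | inj₂ (inj₁ A~C)  = A~C
  ... | inj₂ (inj₂ C~A)  = WeaklyNC-sym {2 + k} {elements C} {elements A} C~A

  layerArcs : ∀ i → 1 ≤ i → i ≤ k → NoncrossingArcs (entryAt i) (entryAt (suc i)) δ
  layerArcs i 1≤i i≤k = record
    { left<right      = λ {A} A∈ → elemsFrom-increasing 1 A 1≤i ≤-refl (1+i≤ A∈)
    ; noncrossing     = λ A∈ C∈ A≢C → proj₁ (proj₂ (proj₂ (weaklyNC A∈ C∈ A≢C))) i 1≤i i≤k
    ; left-injective  = λ A∈ C∈ e →
        sameEntry⇒sameBlock A∈ C∈ (1≤i , <⇒≤ (1+i≤ A∈) , e) (1≤i , <⇒≤ (1+i≤ C∈) , refl)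
    ; right-injective = λ A∈ C∈ e →
        sameEntry⇒sameBlock A∈ C∈ (s≤s z≤n , 1+i≤ A∈ , e) (s≤s z≤n , 1+i≤ C∈ , refl)
    }
    where 1+i≤ : ∀ {A} → A ∈ δ → suc i ≤ length (elements A)
          1+i≤ A∈ = ≤-length A∈ (s≤s (m≤n⇒m≤1+n i≤k))

  tailArcs : NoncrossingArcs (entryAt (suc k)) lastEntry δ
  tailArcs = record
    { left<right      = λ {A} A∈ → elemsFrom-increasing 1 A (s≤s z≤n) (length≥r A∈) ≤-refl
    ; noncrossing     = λ A∈ C∈ A≢C →
        proj₂ (proj₂ (proj₂ (weaklyNC A∈ C∈ A≢C))) _ _ (length≥r A∈) ≤-refl (length≥r C∈) ≤-refl
    ; left-injective  = λ A∈ C∈ e →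
        sameEntry⇒sameBlock A∈ C∈ (s≤s z≤n , 1+k≤ A∈ , e) (s≤s z≤n , 1+k≤ C∈ , refl)
    ; right-injective = λ A∈ C∈ e →
        sameEntry⇒sameBlock A∈ C∈ (1≤length A∈ , ≤-refl , e) (1≤length C∈ , ≤-refl , refl)
    }
    where 1+k≤ : ∀ {A} → A ∈ δ → suc k ≤ length (elements A)
          1+k≤ A∈ = ≤-length A∈ (n≤1+n _)
          1≤length : ∀ {A} → A ∈ δ → 1 ≤ length (elements A)
          1≤length A∈ = ≤-length A∈ (s≤s z≤n)

  middle-bounds : ∀ {A v} → A ∈ δ → Middle k A v → entryAt (suc k) A < v × v < lastEntry A
  middle-bounds {A} A∈ (j , r≤j , j<l , refl) =
    elemsFrom-increasing 1 A (s≤s z≤n) r≤j (<⇒≤ j<l) ,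
    elemsFrom-increasing 1 A (≤-trans (s≤s z≤n) r≤j) j<l ≤-refl

  middle⇒¬ithSmallest : ∀ {A v i} → A ∈ δ → Middle k A v → i ≤ suc k → ¬ IthSmallestSet δ i v
  middle⇒¬ithSmallest {A} A∈ (j , r≤j , j<l , refl) i≤ small with find small
  ... | C , C∈ , entryC@(1≤i , _ , e)
    with sameEntry⇒sameBlock C∈ A∈ entryC (≤-trans (s≤s z≤n) r≤j , <⇒≤ j<l , refl)
  ...   | refl = <-irrefl e (elemsFrom-increasing 1 A 1≤i (≤-trans (s≤s i≤) r≤j) (<⇒≤ j<l))

  middle⇒¬largest : ∀ {A v} → A ∈ δ → Middle k A v → ¬ LargestSet δ v
  middle⇒¬largest {A} A∈ (j , r≤j , j<l , refl) largest with find largest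
  ... | C , C∈ , (1≤l , e)
    with sameEntry⇒sameBlock C∈ A∈ (1≤l , ≤-refl , e) (≤-trans (s≤s z≤n) r≤j , <⇒≤ j<l , refl)
  ...   | refl = <-irrefl (sym e) (elemsFrom-increasing 1 A (≤-trans (s≤s z≤n) r≤j) j<l ≤-refl)

  -- The tail arc of A would cross the arc (a_{r-1}, v) of C.
  ¬tailArc-around-middle : ∀ {A C v} → C ∈ δ → A ∈ δ → Middle k C v →
    entryAt (suc k) C < entryAt (suc k) A → entryAt (suc k) A < v → v < lastEntry A → ⊥
  ¬tailArc-around-middle {A} C∈ A∈ (j , r≤j , j<l , refl) sC<sA sA<v v<eA =
    proj₂ (proj₂ (proj₂ (weaklyNC C∈ A∈ (<-on⇒≢ (entryAt (suc k)) sC<sA))))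
      j (length (elements A)) r≤j (<⇒≤ j<l) (length≥r A∈) ≤-refl (inj₁ (sC<sA , sA<v , v<eA))

module EndpointTransfer {n d k : ℕ} {δ δ′ : List (Subset n)} (wnc : IsWNC n d (2 + k) δ)
  (smallest⇒ : ∀ {i m} → 1 ≤ i → i ≤ suc k → IthSmallestSet δ i m → IthSmallestSet δ′ i m)
  (largest⇒ : ∀ {m} → LargestSet δ m → LargestSet δ′ m) where

  open WNCPartition wnc using (≤-length)

  entry⇒ : ∀ {A i} → A ∈ δ → 1 ≤ i → i ≤ suc k → Σ (Subset n) λ B → B ∈ δ′ × entryAt i B ≡ entryAt i A
  entry⇒ A∈ 1≤i i≤ with find (smallest⇒ 1≤i i≤ (lose A∈ (1≤i , ≤-length A∈ (m≤n⇒m≤1+n i≤) , refl)))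
  ... | B , B∈ , (_ , _ , e) = B , B∈ , e

  lastEntry⇒ : ∀ {A} → A ∈ δ → Σ (Subset n) λ B → B ∈ δ′ × lastEntry B ≡ lastEntry A
  lastEntry⇒ A∈ with find (largest⇒ (lose A∈ (≤-length A∈ (s≤s z≤n) , refl)))
  ... | B , B∈ , (_ , e) = B , B∈ , e

  layerEndpoints : ∀ {i} → 1 ≤ i → i ≤ k → EndpointsIncluded (entryAt i) (entryAt (suc i)) δ δ′
  layerEndpoints 1≤i i≤k = record
    { left∈  = λ A∈ → entry⇒ A∈ 1≤i (m≤n⇒m≤1+n i≤k)
    ; right∈ = λ A∈ → entry⇒ A∈ (s≤s z≤n) (s≤s i≤k)
    }

  tailEndpoints : EndpointsIncluded (entryAt (suc k)) lastEntry δ δ′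
  tailEndpoints = record { left∈ = λ A∈ → entry⇒ A∈ (s≤s z≤n) ≤-refl ; right∈ = lastEntry⇒ }

SameIthSmallest : ℕ → List (Subset n) → List (Subset n) → Set
SameIthSmallest r γ γ′ = ∀ i → 1 ≤ i → i ≤ r ∸ 1 → ∀ m → IthSmallestSet γ i m ⇔ IthSmallestSet γ′ i m

SameLargest : List (Subset n) → List (Subset n) → Set
SameLargest γ γ′ = ∀ m → LargestSet γ m ⇔ LargestSet γ′ m

SameIthSmallest-sym : ∀ {r} {γ γ′ : List (Subset n)} → SameIthSmallest r γ γ′ → SameIthSmallest r γ′ γ
SameIthSmallest-sym same i 1≤i i≤ m = ⇔.sym (same i 1≤i i≤ m)

SameLargest-sym : ∀ {γ γ′ : List (Subset n)} → SameLargest γ γ′ → SameLargest γ′ γ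
SameLargest-sym same m = ⇔.sym (same m)

module Reconstruction {n d k : ℕ} {γ γ′ : List (Subset n)}
  (wnc : IsWNC n d (2 + k) γ) (wnc′ : IsWNC n d (2 + k) γ′)
  (sameSmallest : SameIthSmallest (2 + k) γ γ′) (sameLargest : SameLargest γ γ′) where

  private
    module P  = WNCPartition wnc
    module P′ = WNCPartition wnc′
    smallest⇐ : ∀ {i m} → 1 ≤ i → i ≤ suc k → IthSmallestSet γ′ i m → IthSmallestSet γ i m
    smallest⇐ 1≤i i≤ = Equivalence.from (sameSmallest _ 1≤i i≤ _)
    largest⇐ : ∀ {m} → LargestSet γ′ m → LargestSet γ m
    largest⇐ = Equivalence.from (sameLargest _)
    module T  = EndpointTransfer wnc (λ 1≤i i≤ → Equivalence.to (sameSmallest _ 1≤i i≤ _))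
                                     (Equivalence.to (sameLargest _))
    module T′ = EndpointTransfer wnc′ smallest⇐ largest⇐

  firstEntry-partner : ∀ {A} → A ∈ γ → Σ (Subset n) λ B → B ∈ γ′ × entryAt 1 B ≡ entryAt 1 A
  firstEntry-partner A∈ = T.entry⇒ A∈ (s≤s z≤n) (s≤s z≤n)

  firstEntries-agree : ∀ {A A′} → A ∈ γ → A′ ∈ γ′ → entryAt 1 A ≡ entryAt 1 A′ →
                       ∀ j → 1 ≤ j → j ≤ suc k → entryAt j A ≡ entryAt j A′
  firstEntries-agree A∈ A′∈ first≡ (suc zero)    _ _ = first≡
  firstEntries-agree A∈ A′∈ first≡ (suc (suc i)) _ (s≤s i<k) =
    sameLeft⇒sameRight (P.layerArcs (suc i) 1≤ i<k) (P′.layerArcs (suc i) 1≤ i<k)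
      (T.layerEndpoints 1≤ i<k) (T′.layerEndpoints 1≤ i<k) A∈ A′∈
      (firstEntries-agree A∈ A′∈ first≡ (suc i) 1≤ (m≤n⇒m≤1+n i<k))
    where 1≤ = s≤s z≤n

  tailStart-agree : ∀ {A A′} → A ∈ γ → A′ ∈ γ′ →
                    entryAt 1 A ≡ entryAt 1 A′ → entryAt (suc k) A ≡ entryAt (suc k) A′
  tailStart-agree A∈ A′∈ first≡ = firstEntries-agree A∈ A′∈ first≡ (suc k) (s≤s z≤n) ≤-refl

  lastEntry-agree : ∀ {A A′} → A ∈ γ → A′ ∈ γ′ →
                    entryAt (suc k) A ≡ entryAt (suc k) A′ → lastEntry A ≡ lastEntry A′
  lastEntry-agree = sameLeft⇒sameRight P.tailArcs P′.tailArcs T.tailEndpoints T′.tailEndpoints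

  middle⇒middle : ∀ {A B′ j v} → A ∈ γ → Middle k A v →
                  B′ ∈ γ′ → Entry (elements B′) j v → Middle k B′ v
  middle⇒middle A∈ middle B′∈ entry@(1≤j , j≤l , e) with j≤l⇒j≤m⊎j≡l⊎m<j<l (suc k) j≤l
  ... | inj₁ j≤ = ⊥-elim (P.middle⇒¬ithSmallest A∈ middle j≤ (smallest⇐ 1≤j j≤ (lose B′∈ entry)))
  ... | inj₂ (inj₁ refl) = ⊥-elim (P.middle⇒¬largest A∈ middle (largest⇐ (lose B′∈ (1≤j , e))))
  ... | inj₂ (inj₂ (r≤j , j<l)) = _ , r≤j , j<l , e

  middle-⊆ : ∀ {A A′ x} → A ∈ γ → A′ ∈ γ′ →
    entryAt (suc k) A ≡ entryAt (suc k) A′ → Middle k A (suc (toℕ x)) → x ∈ₛ A′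
  middle-⊆ {A} {A′} {x} A∈ A′∈ sA≡sA′ middle with find (P′.cover x)
  ... | B′ , B′∈ , x∈B′ with middle⇒middle A∈ middle B′∈ (proj₂ (∈⇒Entry 1 B′ x∈B′))
  ... | middle′ with <-cmp (entryAt (suc k) B′) (entryAt (suc k) A′)
  ... | tri≈ _ sB′≡sA′ _ = subst (x ∈ₛ_) (left-injective P′.tailArcs B′∈ A′∈ sB′≡sA′) x∈B′
  ... | tri< sB′<sA′ _ _ = ⊥-elim $
    P′.¬tailArc-around-middle B′∈ A′∈ middle′ sB′<sA′ (subst (_< _) sA≡sA′ sA<x)
      (subst (_ <_) (lastEntry-agree A∈ A′∈ sA≡sA′) x<eA)
    where open Σ (P.middle-bounds A∈ middle) renaming (proj₁ to sA<x; proj₂ to x<eA)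
  ... | tri> _ _ sA′<sB′ with left∈ T′.tailEndpoints B′∈
  ...   | B , B∈ , sB≡sB′ = ⊥-elim $
    P.¬tailArc-around-middle A∈ B∈ middle (subst₂ _<_ (sym sA≡sA′) (sym sB≡sB′) sA′<sB′)
      (subst (_< _) (sym sB≡sB′) sB′<x) (subst (_ <_) (sym (lastEntry-agree B∈ B′∈ sB≡sB′)) x<eB′)
    where open Σ (P′.middle-bounds B′∈ middle′) renaming (proj₁ to sB′<x; proj₂ to x<eB′)

  sameFirst⇒⊆ : ∀ {A A′} → A ∈ γ → A′ ∈ γ′ → entryAt 1 A ≡ entryAt 1 A′ → A ⊆ A′
  sameFirst⇒⊆ {A} {A′} A∈ A′∈ first≡ {x} x∈A with ∈⇒Entry 1 A x∈A
  ... | j , entry@(1≤j , j≤l , e) with j≤l⇒j≤m⊎j≡l⊎m<j<l (suc k) j≤l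
  ... | inj₁ j≤ =
    elements-Entry⇒∈ x (1≤j , P′.≤-length A′∈ (m≤n⇒m≤1+n j≤) ,
                        trans (sym (firstEntries-agree A∈ A′∈ first≡ j 1≤j j≤)) e)
  ... | inj₂ (inj₁ refl) =
    elements-Entry⇒∈ x (P′.≤-length A′∈ (s≤s z≤n) , ≤-refl ,
                        trans (sym (lastEntry-agree A∈ A′∈ (tailStart-agree A∈ A′∈ first≡))) e)
  ... | inj₂ (inj₂ (r≤j , j<l)) = middle-⊆ A∈ A′∈ (tailStart-agree A∈ A′∈ first≡) (j , r≤j , j<l , e)

module _ {n d k : ℕ} {γ γ′ : List (Subset n)}
  (wnc : IsWNC n d (2 + k) γ) (wnc′ : IsWNC n d (2 + k) γ′)
  (sameSmallest : SameIthSmallest (2 + k) γ γ′) (sameLargest : SameLargest γ γ′) where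

  private
    module R  = Reconstruction wnc wnc′ sameSmallest sameLargest
    module R′ = Reconstruction wnc′ wnc (SameIthSmallest-sym {r = 2 + k} sameSmallest)
                                        (SameLargest-sym sameLargest)

  block-transfer : ∀ {B} → B ∈ γ → B ∈ γ′
  block-transfer B∈ with R.firstEntry-partner B∈
  ... | B′ , B′∈ , first≡ =
    subst (_∈ γ′) (⊆-antisym (R′.sameFirst⇒⊆ B′∈ B∈ first≡) (R.sameFirst⇒⊆ B∈ B′∈ (sym first≡)))
      B′∈

mainTheorem5 : (n d r : ℕ) → 2 ≤ r → (γ γ′ : List (Subset n)) →
    IsWNC n d r γ → IsWNC n d r γ′ →
    (∀ i → 1 ≤ i → i ≤ r ∸ 1 → ∀ m → IthSmallestSet γ i m ⇔ IthSmallestSet γ′ i m) →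
    (∀ m → LargestSet γ m ⇔ LargestSet γ′ m) →
    ∀ (B : Subset n) → B ∈ γ ⇔ B ∈ γ′
mainTheorem5 n d (suc (suc k)) (s≤s (s≤s z≤n)) γ γ′ wnc wnc′ sameSmallest sameLargest _ =
  mk⇔ (block-transfer wnc wnc′ sameSmallest sameLargest)
      (block-transfer wnc′ wnc (SameIthSmallest-sym {r = 2 + k} sameSmallest) (SameLargest-sym sameLargest))
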